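{- Let $G$ be a strongly connected digraph with diameter at most $2$ that contains the pattern $\mathcal{F}_2$, i.e. there are three distinct vertices $u,v,w$ of $G$ such that $(u,v),(u,w),(v,w),(w,u),(w,v)$ are arcs of $G$ and $(v,u)$ is not an arc of $G$. Then $I_2(G)=\langle 1\rangle$.
   Context: A digraph is simple: no loops and no multiple arcs. It is strongly connected if for all vertices $u,v$ there is a directed $uv$-walk. $\operatorname{dist}(u,v)$ is the number of arcs of a shortest directed $uv$-walk; the diameter is the maximum distance. $D_X(G)=\operatorname{diag}(x_u)_{u\in V(G)}+D(G)$, where $D(G)$ is the distance matrix and $x_u$ are indeterminates; $I_2(G)$ is the ideal of $\mathbb{Z}[x_u:u\in V(G)]$ generated by all $2\times 2$ minors of $D_X(G)$. -}

module Defs where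

open import Level using (0ℓ)
open import Data.Nat using (ℕ; zero; suc; _≤_)
open import Data.Fin using (Fin; _<_)
open import Data.Fin.Properties using (_≟_)
open import Data.List using (List; []; _∷_)
open import Data.Product using (Σ; _×_; _,_; ∃)
open import Relation.Nullary using (¬_; yes; no)
open import Relation.Binary.PropositionalEquality using (_≡_)
open import Algebra.Bundles using (CommutativeRing)

record Digraph (n : ℕ) : Set₁ where
  field
    Arc      : Fin n → Fin n → Set
    loopless : ∀ u → ¬ Arc u u
open Digraph public

data Walk {n : ℕ} (G : Digraph n) : Fin n → Fin n → ℕ → Set where
  here : ∀ {u} → Walk G u u 0
  step : ∀ {u w v k} → Arc G u w → Walk G w v k → Walk G u v (suc k)

StronglyConnected : ∀ {n} → Digraph n → Set
StronglyConnected G = ∀ u v → ∃ λ k → Walk G u v k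

-- d is the distance function of G: d u v is the number of arcs of a
-- shortest directed uv-walk.  (For strongly connected G such d exists
-- and is unique.)
IsDistance : ∀ {n} → Digraph n → (Fin n → Fin n → ℕ) → Set
IsDistance G d =
  ∀ u v → Walk G u v (d u v) × (∀ k → Walk G u v k → d u v ≤ k)

DiameterAtMost2 : ∀ {n} → (Fin n → Fin n → ℕ) → Set
DiameterAtMost2 d = ∀ u v → d u v ≤ 2

ContainsF2 : ∀ {n} → Digraph n → Set
ContainsF2 {n} G = Σ (Fin n) λ u → Σ (Fin n) λ v → Σ (Fin n) λ w →
  ¬ u ≡ v × ¬ u ≡ w × ¬ v ≡ w ×
  Arc G u v × Arc G u w × Arc G v w × Arc G w u × Arc G w v ×
  ¬ Arc G v u

-- The polynomial ring ℤ[x_u : u ∈ Fin n].  Elements are written as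
-- expressions (ℕ-constants and negation generate all ℤ-coefficients);
-- two expressions are equal in ℤ[x] iff they agree under every
-- evaluation in every commutative ring (universal property of the
-- free commutative ring ℤ[x]).

data Poly (n : ℕ) : Set where
  var : Fin n → Poly n
  con : ℕ → Poly n
  _⊕_ : Poly n → Poly n → Poly n
  _⊗_ : Poly n → Poly n → Poly n
  ⊝_  : Poly n → Poly n

infixl 6 _⊕_
infixl 7 _⊗_

module _ (R : CommutativeRing 0ℓ 0ℓ) where
  open CommutativeRing R

  natR : ℕ → Carrier
  natR zero    = 0#
  natR (suc k) = 1# + natR k

  eval : ∀ {n} → (Fin n → Carrier) → Poly n → Carrier
  eval ρ (var i) = ρ i
  eval ρ (con k) = natR k
  eval ρ (p ⊕ q) = eval ρ p + eval ρ q
  eval ρ (p ⊗ q) = eval ρ p * eval ρ q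
  eval ρ (⊝ p)   = - eval ρ p

_≈ₚ_ : ∀ {n} → Poly n → Poly n → Set₁
p ≈ₚ q = ∀ (R : CommutativeRing 0ℓ 0ℓ) (ρ : Fin _ → CommutativeRing.Carrier R) →
  CommutativeRing._≈_ R (eval R ρ p) (eval R ρ q)

DX : ∀ {n} → (Fin n → Fin n → ℕ) → Fin n → Fin n → Poly n
DX d i j with i ≟ j
... | yes _ = var i ⊕ con (d i j)
... | no  _ = con (d i j)

record MinorIndex (n : ℕ) : Set where
  constructor minorIx
  field
    r₁ r₂ c₁ c₂ : Fin n
    r< : r₁ < r₂
    c< : c₁ < c₂

minor : ∀ {n} → (Fin n → Fin n → Poly n) → MinorIndex n → Poly n
minor M (minorIx i j k l _ _) = M i k ⊗ M j l ⊕ ⊝ (M i l ⊗ M j k)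

combo : ∀ {n} → (Fin n → Fin n → Poly n) → List (Poly n × MinorIndex n) → Poly n
combo M []             = con 0
combo M ((c , m) ∷ cs) = c ⊗ minor M m ⊕ combo M cs

I2IsUnit : ∀ {n} → (Fin n → Fin n → Poly n) → Set₁
I2IsUnit {n} M = Σ (List (Poly n × MinorIndex n)) λ cs → combo M cs ≈ₚ con 1

{-# OPTIONS --safe #-}
module Submission where

open import Defs
open import Data.Nat using (ℕ; _≤_; s≤s)
open import Data.Fin using (Fin; _<_)

open import Level using (0ℓ)
open import Data.Fin.Properties using (_≟_; <-cmp)
open import Data.List using (List; []; _∷_; _++_; map)
open import Data.Product using (_×_; _,_; proj₁; proj₂)
open import Data.Empty using (⊥-elim)
open import Relation.Nullary using (¬_; yes; no)
open import Relation.Binary.Definitions using (tri<; tri≈; tri>)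
open import Relation.Binary.PropositionalEquality as ≡ using (_≡_; _≢_; refl)
open import Algebra.Bundles using (CommutativeRing)
open import Function using (_∘_)

-- In D_X(G) the minor on rows (u, w), columns (u, v) is x_u - 1 and the minor on
-- rows (v, u), columns (u, w) is 2 - x_u: apart from x_u, their entries are the
-- distances along the five arcs of F₂, which are 1, and dist(v, u), which is 2
-- because (v, u) is not an arc and the diameter is at most 2.  Their sum is 1.

module RingIdentities (R : CommutativeRing 0ℓ 0ℓ) where
  open CommutativeRing R
  open import Algebra.Properties.Ring ring using (-‿distribˡ-*; -‿+-comm; ⁻¹-anti-homo‿-; [y-z]x≈yx-zx)
  open import Relation.Binary.Reasoning.Setoid setoid

  -‿distribˡ-*-+ : ∀ c m r → - c * m - r ≈ - (c * m + r)
  -‿distribˡ-*-+ c m r = trans (+-congʳ (sym (-‿distribˡ-* c m))) (-‿+-comm (c * m) r)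

  neg-det-swap-rows : ∀ a b c e → - (e * c - b * a) ≈ a * b - c * e
  neg-det-swap-rows a b c e =
    trans (⁻¹-anti-homo‿- (e * c) (b * a)) (+-cong (*-comm b a) (-‿cong (*-comm e c)))

  neg-det-swap-cols : ∀ a b c e → - (c * e - a * b) ≈ a * b - c * e
  neg-det-swap-cols a b c e = ⁻¹-anti-homo‿- (c * e) (a * b)

  telescope : ∀ a b c → (a - b) + (c - a) ≈ c - b
  telescope a b c = begin
    (a - b) + (c - a)   ≈⟨ +-comm _ _ ⟩
    (c - a) + (a - b)   ≈⟨ +-assoc _ _ _ ⟩
    c + (- a + (a - b)) ≈⟨ +-congˡ (+-assoc _ _ _) ⟨
    c + ((- a + a) - b) ≈⟨ +-congˡ (+-congʳ (-‿inverseˡ a)) ⟩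
    c + (0# - b)        ≈⟨ +-congˡ (+-identityˡ _) ⟩
    c - b               ∎

  F2-minors-sum-identity : ∀ x → let one = natR R 1; two = natR R 2 in
    (x * one - one * one) + (two * one - one * x) ≈ one
  F2-minors-sum-identity x = begin
    (x * one - one * one) + (two * one - one * x) ≈⟨ +-congˡ (+-congˡ (-‿cong (*-comm one x))) ⟩
    (x * one - one * one) + (two * one - x * one) ≈⟨ telescope _ _ _ ⟩
    two * one - one * one                         ≈⟨ [y-z]x≈yx-zx one two one ⟨
    (two - one) * one                             ≈⟨ trans (*-congˡ one≈1) (*-identityʳ _) ⟩
    (1# + one) - one                              ≈⟨ +-assoc _ _ _ ⟩
    1# + (one - one)                              ≈⟨ +-congˡ (-‿inverseʳ one) ⟩
    one                                           ∎
    where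
    one = natR R 1
    two = natR R 2
    one≈1 : one ≈ 1#
    one≈1 = +-identityʳ 1#

module _ {n} {G : Digraph n} where

  arc⇒≢ : ∀ {a b} → Arc G a b → a ≢ b
  arc⇒≢ {a} ab refl = loopless G a ab

  walk≤1⇒length≡1 : ∀ {a b k} → a ≢ b → Walk G a b k → k ≤ 1 → k ≡ 1
  walk≤1⇒length≡1 a≢b here                _               = ⊥-elim (a≢b refl)
  walk≤1⇒length≡1 _   (step _ here)       _               = refl
  walk≤1⇒length≡1 _   (step _ (step _ _)) (s≤s ())

  walk≤2⇒length≡2 : ∀ {a b k} → a ≢ b → ¬ Arc G a b → Walk G a b k → k ≤ 2 → k ≡ 2
  walk≤2⇒length≡2 a≢b _   here                       _ = ⊥-elim (a≢b refl)
  walk≤2⇒length≡2 _   ¬ab (step ab here)             _ = ⊥-elim (¬ab ab)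
  walk≤2⇒length≡2 _   _   (step _ (step _ here))     _ = refl
  walk≤2⇒length≡2 _   _   (step _ (step _ (step _ _))) (s≤s (s≤s ()))

  module _ {d : Fin n → Fin n → ℕ} (isDistance : IsDistance G d) where

    arc⇒distance≡1 : ∀ {a b} → Arc G a b → d a b ≡ 1
    arc⇒distance≡1 {a} {b} ab =
      walk≤1⇒length≡1 (arc⇒≢ ab) (proj₁ (isDistance a b)) (proj₂ (isDistance a b) 1 (step ab here))

    non-arc⇒distance≡2 : DiameterAtMost2 d → ∀ {a b} → a ≢ b → ¬ Arc G a b → d a b ≡ 2
    non-arc⇒distance≡2 diameter≤2 {a} {b} a≢b ¬ab =
      walk≤2⇒length≡2 a≢b ¬ab (proj₁ (isDistance a b)) (diameter≤2 a b)

DX-off-diagonal : ∀ {n} (d : Fin n → Fin n → ℕ) {a b} → a ≢ b → DX d a b ≡ con (d a b)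
DX-off-diagonal d {a} {b} a≢b with a ≟ b
... | yes a≡b = ⊥-elim (a≢b a≡b)
... | no _    = refl

module _ {n} {G : Digraph n} {d : Fin n → Fin n → ℕ} (isDistance : IsDistance G d) where

  DX-arc : ∀ {a b} → Arc G a b → DX d a b ≡ con 1
  DX-arc ab = ≡.trans (DX-off-diagonal d (arc⇒≢ {G = G} ab)) (≡.cong con (arc⇒distance≡1 isDistance ab))

  DX-non-arc : DiameterAtMost2 d → ∀ {a b} → a ≢ b → ¬ Arc G a b → DX d a b ≡ con 2
  DX-non-arc diameter≤2 a≢b ¬ab =
    ≡.trans (DX-off-diagonal d a≢b) (≡.cong con (non-arc⇒distance≡2 isDistance diameter≤2 a≢b ¬ab))

det₂ : ∀ {n} → (Fin n → Fin n → Poly n) → Fin n → Fin n → Fin n → Fin n → Poly n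
det₂ M a b c e = M a c ⊗ M b e ⊕ ⊝ (M a e ⊗ M b c)

-- A record rather than a Σ-type as in I2IsUnit, so that M and p stay inferable:
-- _≈ₚ_ unfolds to a function type in which p occurs only under eval.
record InI₂ {n} (M : Fin n → Fin n → Poly n) (p : Poly n) : Set₁ where
  constructor inI₂
  field
    coefficients : List (Poly n × MinorIndex n)
    combo≈       : combo M coefficients ≈ₚ p

det₂-swap-rows : ∀ {n} (M : Fin n → Fin n → Poly n) a b c e → (⊝ det₂ M b a c e) ≈ₚ det₂ M a b c e
det₂-swap-rows M a b c e R ρ = RingIdentities.neg-det-swap-rows R _ _ _ _

det₂-swap-cols : ∀ {n} (M : Fin n → Fin n → Poly n) a b c e → (⊝ det₂ M a b e c) ≈ₚ det₂ M a b c e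
det₂-swap-cols M a b c e R ρ = RingIdentities.neg-det-swap-cols R _ _ _ _

module _ {n} {M : Fin n → Fin n → Poly n} where

  InI₂-resp : ∀ {p q} → p ≈ₚ q → InI₂ M p → InI₂ M q
  InI₂-resp p≈q (inI₂ cs cs≈p) = inI₂ cs λ R ρ → CommutativeRing.trans R (cs≈p R ρ) (p≈q R ρ)

  combo-++ : ∀ cs ds → combo M (cs ++ ds) ≈ₚ (combo M cs ⊕ combo M ds)
  combo-++ []             ds R ρ = sym (+-identityˡ _)
    where open CommutativeRing R
  combo-++ ((c , m) ∷ cs) ds R ρ = trans (+-congˡ (combo-++ cs ds R ρ)) (sym (+-assoc _ _ _))
    where open CommutativeRing R

  InI₂-⊕ : ∀ {p q} → InI₂ M p → InI₂ M q → InI₂ M (p ⊕ q)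
  InI₂-⊕ (inI₂ cs cs≈p) (inI₂ ds ds≈q) =
    inI₂ (cs ++ ds) λ R ρ → let open CommutativeRing R in
      trans (combo-++ cs ds R ρ) (+-cong (cs≈p R ρ) (ds≈q R ρ))

  negate-coefficient : Poly n × MinorIndex n → Poly n × MinorIndex n
  negate-coefficient (c , m) = ⊝ c , m

  combo-negate : ∀ cs → combo M (map negate-coefficient cs) ≈ₚ (⊝ combo M cs)
  combo-negate []             R ρ = CommutativeRing.sym R (-0#≈0#)
    where open import Algebra.Properties.Ring (CommutativeRing.ring R) using (-0#≈0#)
  combo-negate ((c , m) ∷ cs) R ρ =
    trans (+-congˡ (combo-negate cs R ρ)) (RingIdentities.-‿distribˡ-*-+ R _ _ _)
    where open CommutativeRing R

  InI₂-⊝ : ∀ {p} → InI₂ M p → InI₂ M (⊝ p)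
  InI₂-⊝ (inI₂ cs cs≈p) =
    inI₂ (map negate-coefficient cs) λ R ρ → let open CommutativeRing R in
      trans (combo-negate cs R ρ) (-‿cong (cs≈p R ρ))

  minor∈I₂ : ∀ m → InI₂ M (minor M m)
  minor∈I₂ m = inI₂ ((con 1 , m) ∷ []) λ R ρ →
    let open CommutativeRing R in
    trans (+-identityʳ _) (trans (*-congʳ (+-identityʳ 1#)) (*-identityˡ _))

  det₂∈I₂-rows< : ∀ {a b c e} → a < b → c ≢ e → InI₂ M (det₂ M a b c e)
  det₂∈I₂-rows< {a} {b} {c} {e} a<b c≢e with <-cmp c e
  ... | tri< c<e _ _ = minor∈I₂ (minorIx a b c e a<b c<e)
  ... | tri≈ _ c≡e _ = ⊥-elim (c≢e c≡e)
  ... | tri> _ _ e<c = InI₂-resp (det₂-swap-cols M a b c e) (InI₂-⊝ (minor∈I₂ (minorIx a b e c a<b e<c)))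

  det₂∈I₂ : ∀ {a b c e} → a ≢ b → c ≢ e → InI₂ M (det₂ M a b c e)
  det₂∈I₂ {a} {b} {c} {e} a≢b c≢e with <-cmp a b
  ... | tri< a<b _ _ = det₂∈I₂-rows< a<b c≢e
  ... | tri≈ _ a≡b _ = ⊥-elim (a≢b a≡b)
  ... | tri> _ _ b<a = InI₂-resp (det₂-swap-rows M a b c e) (InI₂-⊝ (det₂∈I₂-rows< b<a c≢e))

F2-minors-sum : ∀ {n} (M : Fin n → Fin n → Poly n) {u v w} →
  M u v ≡ con 1 → M u w ≡ con 1 → M v w ≡ con 1 → M w u ≡ con 1 → M w v ≡ con 1 → M v u ≡ con 2 →
  (det₂ M u w u v ⊕ det₂ M v u u w) ≈ₚ con 1
F2-minors-sum M {u} uv uw vw wu wv vu R ρ rewrite uv | uw | vw | wu | wv | vu =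
  RingIdentities.F2-minors-sum-identity R (eval R ρ (M u u))

lemma10 : ∀ {n} (G : Digraph n) (d : Fin n → Fin n → ℕ) →
    IsDistance G d → StronglyConnected G → DiameterAtMost2 d →
    ContainsF2 G → I2IsUnit (DX d)
lemma10 G d isDistance _ diameter≤2 (u , v , w , u≢v , u≢w , _ , uv , uw , vw , wu , wv , ¬vu) =
  coefficients , combo≈
  where
  v≢u : v ≢ u
  v≢u = u≢v ∘ ≡.sym
  unit∈I₂ : InI₂ (DX d) (con 1)
  unit∈I₂ = InI₂-resp
    (F2-minors-sum (DX d) (DX-arc isDistance uv) (DX-arc isDistance uw) (DX-arc isDistance vw)
      (DX-arc isDistance wu) (DX-arc isDistance wv) (DX-non-arc isDistance diameter≤2 v≢u ¬vu))
    (InI₂-⊕ (det₂∈I₂ u≢w u≢v) (det₂∈I₂ v≢u u≢w))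
  open InI₂ unit∈I₂
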